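{- For any Boolean CQ $Q_{\mathrm{sec}}$ and CQ views ${\mathcal V}$, ${\mathcal V}$ is UN non-disclosing for $Q_{\mathrm{sec}}$ if and only if ${\mathcal V}$ is UN non-disclosing for $\mathrm{CanV}^s(Q_{\mathrm{sec}})$ for some source $s$.
   Context: Setting: a distributed schema (d-schema) with finitely many sources, each with its own local schema (pairwise disjoint relations); ${\mathcal V}$ is a d-view, assigning to each source a finite set of conjunctive-query (CQ) views over that source's local schema. Queries are Boolean CQs without constants; there is no background knowledge. For a CQ $Q$ and source $s$, $\mathrm{SVars}(s,Q)$ is the set of variables of $Q$ occurring in an atom of source $s$, and $\mathrm{SJVars}(s,Q)$ (source-join variables) is the subset of those that also occur in an atom of another source. The canonical view $\mathrm{CanV}^s(Q)$ is the conjunction of all source-$s$ atoms of $Q$, with the bound variables of $Q$ in $\mathrm{SVars}(s,Q)\setminus\mathrm{SJVars}(s,Q)$ existentially quantified (so its free variables are the source-join variables of $s$). ${\mathcal V}$ determines a query $Q'$ at an instance $I$ if $Q'$ has the same answer on every instance on which all views of ${\mathcal V}$ agree with $I$. ${\mathcal V}$ is UN (universal non-inference) non-disclosing for a CQ $Q_{\mathrm{sec}}$ if for every instance $I$ and tuple $\vec t$ with $I,\vec t\models Q_{\mathrm{sec}}$, ${\mathcal V}$ does not determine $Q_{\mathrm{sec}}(\vec t)$ at $I$. -}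

module Defs where

open import Data.Nat using (ℕ)
open import Data.Fin using (Fin)
open import Data.Fin.Properties using (_≟_)
open import Data.Vec using (Vec)
import Data.Vec as Vec
open import Data.List using (List; []; map; filter; allFin)
open import Data.List.Relation.Unary.All using (All)
open import Data.List.Relation.Unary.Any using (Any; any?)
open import Data.List.Membership.Propositional using (_∈_)
open import Data.Product using (Σ; ∃; _×_; _,_)
open import Relation.Nullary using (¬_; Dec)
open import Relation.Nullary.Decidable using (_×-dec_; ¬?)
open import Relation.Binary.PropositionalEquality using (_≡_)
open import Function.Bundles using (_⇔_)

-- A distributed schema: finitely many sources, finitely many relations,
-- each relation has an arity and belongs to exactly one source
-- (so the local schemas are pairwise disjoint).
record DSchema : Set where
  field
    nSources : ℕ
    nRels    : ℕ
    arity    : Fin nRels → ℕ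
    source   : Fin nRels → Fin nSources

module _ (𝒮 : DSchema) where
  open DSchema 𝒮

  -- Values: the (countably infinite) domain ℕ.
  -- A (finite) instance assigns a finite set (list) of tuples to each relation.
  Instance : Set
  Instance = (r : Fin nRels) → List (Vec ℕ (arity r))

  record Atom (nv : ℕ) : Set where
    constructor atom
    field
      rel  : Fin nRels
      args : Vec (Fin nv) (arity rel)
  open Atom public

  -- A conjunctive query: variables Fin nVars, free (head) variables `head`,
  -- body a conjunction of atoms; variables not in the head are existentially
  -- quantified.
  record CQ : Set where
    constructor cq
    field
      nVars : ℕ
      head  : List (Fin nVars)
      body  : List (Atom nVars)
  open CQ public

  IsBoolean : CQ → Set
  IsBoolean Q = head Q ≡ []

  Sat : Instance → (Q : CQ) → List ℕ → Set
  Sat I Q t = Σ (Fin (nVars Q) → ℕ) λ h →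
    All (λ a → Vec.map h (args a) ∈ I (rel a)) (body Q) × map h (head Q) ≡ t

  OverSource : Fin nSources → CQ → Set
  OverSource s Q = All (λ a → source (rel a) ≡ s) (body Q)

  DView : Set
  DView = Fin nSources → List CQ

  IsDView : DView → Set
  IsDView V = ∀ s → All (OverSource s) (V s)

  ViewsAgree : DView → Instance → Instance → Set
  ViewsAgree V I J = ∀ s q → q ∈ V s → ∀ t → (Sat I q t ⇔ Sat J q t)

  Determines : DView → CQ → Instance → List ℕ → Set
  Determines V Q I t = ∀ J → ViewsAgree V I J → (Sat I Q t ⇔ Sat J Q t)

  UNNonDisclosing : DView → CQ → Set
  UNNonDisclosing V Q = ∀ I t → Sat I Q t → ¬ Determines V Q I t

  OccursInSource : (Q : CQ) → Fin nSources → Fin (nVars Q) → Set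
  OccursInSource Q s x =
    Any (λ a → source (rel a) ≡ s × x ∈ Vec.toList (args a)) (body Q)

  OccursInOtherSource : (Q : CQ) → Fin nSources → Fin (nVars Q) → Set
  OccursInOtherSource Q s x =
    Any (λ a → ¬ (source (rel a) ≡ s) × x ∈ Vec.toList (args a)) (body Q)

  _∈?F_ : ∀ {n} (x : Fin n) (xs : List (Fin n)) → Dec (x ∈ xs)
  x ∈?F xs = any? (x ≟_) xs

  occursInSource? : (Q : CQ) → (s : Fin nSources) → (x : Fin (nVars Q)) →
                    Dec (OccursInSource Q s x)
  occursInSource? Q s x =
    any? (λ a → (source (rel a) ≟ s) ×-dec (x ∈?F Vec.toList (args a))) (body Q)

  occursInOtherSource? : (Q : CQ) → (s : Fin nSources) → (x : Fin (nVars Q)) →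
                         Dec (OccursInOtherSource Q s x)
  occursInOtherSource? Q s x =
    any? (λ a → ¬? (source (rel a) ≟ s) ×-dec (x ∈?F Vec.toList (args a))) (body Q)

  SJVars : Fin nSources → (Q : CQ) → List (Fin (nVars Q))
  SJVars s Q =
    filter (λ x → occursInSource? Q s x ×-dec occursInOtherSource? Q s x)
           (allFin (nVars Q))

  CanV : Fin nSources → CQ → CQ
  CanV s Q = cq (nVars Q) (SJVars s Q)
                (filter (λ a → source (rel a) ≟ s) (body Q))

module Submission where

open import Defs
open import Data.Product using (∃)
open import Function.Bundles using (_⇔_)

open import Function.Bundles using (mk⇔; Equivalence)
import Function.Properties.Equivalence as ⇔
open import Function using (_∘_)
open import Data.Nat as ℕ using (ℕ; zero; suc; _+_; _*_; _<_; _≤_; z≤n; s≤s)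
import Data.Nat.Properties as ℕP
open import Data.Nat.ListAction using (sum)
open import Data.Nat.DivMod using (_/_; _%_)
import Data.Nat.DivMod as DivMod
open import Data.Nat.Divisibility using (n∣m*n)
open import Data.Fin as Fin using (Fin; toℕ)
open import Data.Fin.Properties using (_≟_; toℕ<n)
import Data.Fin.Properties as FinP
open import Data.Vec as Vec using (Vec)
import Data.Vec.Properties as VecP
open import Data.List as List
  using (List; []; _∷_; _++_; map; filter; allFin; concatMap; length; upTo; cartesianProductWith)
import Data.List.Properties as ListP
open import Data.List.Relation.Unary.All as All using (All; []; _∷_)
import Data.List.Relation.Unary.All.Properties as AllP
open import Data.List.Relation.Unary.Any as Any using (Any; here; there; any?)
open import Data.List.Membership.Propositional using (_∈_; find; lose)
open import Data.List.Membership.Propositional.Properties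
open import Data.Product using (_×_; _,_; proj₁; proj₂)
open import Data.Empty using (⊥-elim)
open import Relation.Nullary using (¬_; Dec; yes; no)
open import Relation.Nullary.Decidable using (_×-dec_; _→-dec_; ¬?; map′)
open import Relation.Binary.PropositionalEquality
  using (_≡_; _≢_; refl; sym; trans; cong; cong₂; subst; _≗_; module ≡-Reasoning)

-- Everything is reduced to a single instance, the critical instance Crit with
-- one all-zero fact per relation, which satisfies every CQ at (0,...,0).  Say
-- Q is DeterminedAtCrit when V determines Q(0,...,0) at Crit.
--  (1) A safe query (its head variables occur in its body) is UN
--      non-disclosing iff it is not DeterminedAtCrit.  One direction is the
--      definition instantiated at Crit.  For the other, an instance J that
--      agrees with Crit on the views but refutes Q(0,...,0) is multiplied with
--      any I ⊨ Q(t); the product agrees with I on the views and refutes Q(t).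
--  (2) A Boolean Q is DeterminedAtCrit iff all its canonical views are:
--      restricting J to one source preserves agreement with Crit, and
--      conversely witnesses for the canonical views glue along the
--      source-join variables, which all of them send to 0.
--  (3) DeterminedAtCrit is decidable, by a small model property; this is what
--      lets us name the source s in the forward direction constructively.

map-≡⇒∈ : ∀ {A B : Set} {f g : A → B} (xs : List A) →
          map f xs ≡ map g xs → ∀ {x} → x ∈ xs → f x ≡ g x
map-≡⇒∈ (y ∷ xs) e (here refl) = ListP.∷-injectiveˡ e
map-≡⇒∈ (y ∷ xs) e (there m)   = map-≡⇒∈ xs (ListP.∷-injectiveʳ e) m

map-cong-∈ : ∀ {A B : Set} {f g : A → B} (xs : List A) →
             (∀ {x} → x ∈ xs → f x ≡ g x) → map f xs ≡ map g xs
map-cong-∈ xs e = ListP.map-cong-local (All.tabulate e)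

vmap-cong-∈ : ∀ {A B : Set} {f g : A → B} {n} (v : Vec A n) →
              (∀ {x} → x ∈ Vec.toList v → f x ≡ g x) → Vec.map f v ≡ Vec.map g v
vmap-cong-∈ Vec.[]       e = refl
vmap-cong-∈ (x Vec.∷ v) e = cong₂ Vec._∷_ (e (here refl)) (vmap-cong-∈ v (e ∘ there))

vmap-≡-replicate : ∀ {A B : Set} {f : A → B} {n} (v : Vec A n) {k} →
                   Vec.map f v ≡ Vec.replicate n k → ∀ {x} → x ∈ Vec.toList v → f x ≡ k
vmap-≡-replicate (y Vec.∷ v) e (here refl) = VecP.∷-injectiveˡ e
vmap-≡-replicate (y Vec.∷ v) e (there m)   = vmap-≡-replicate v (VecP.∷-injectiveʳ e) m

∈-vmap⁺ : ∀ {A B : Set} (f : A → B) {n} (v : Vec A n) {x} →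
          x ∈ Vec.toList v → f x ∈ Vec.toList (Vec.map f v)
∈-vmap⁺ f v {x} m = subst (f x ∈_) (sym (VecP.toList-map f v)) (∈-map⁺ f m)

vmap-zipWith : ∀ {A B C D : Set} (_⊕_ : B → C → D) (f : A → B) (g : A → C) {n} (v : Vec A n) →
               Vec.map (λ x → f x ⊕ g x) v ≡ Vec.zipWith _⊕_ (Vec.map f v) (Vec.map g v)
vmap-zipWith _⊕_ f g Vec.[]       = refl
vmap-zipWith _⊕_ f g (x Vec.∷ v) = cong (f x ⊕ g x Vec.∷_) (vmap-zipWith _⊕_ f g v)

≤-sum : ∀ {v} (xs : List ℕ) → v ∈ xs → v ≤ sum xs
≤-sum (x ∷ xs) (here refl) = ℕP.m≤m+n x (sum xs)
≤-sum (x ∷ xs) (there m)   = ℕP.≤-trans (≤-sum xs m) (ℕP.m≤n+m (sum xs) x)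

-- They make the search spaces of the decision
-- procedure explicit: valuations with values in a finite set, and instances
-- whose relations are subsets of a fixed finite set of tuples.

vectorsOver : ∀ {A : Set} → List A → (k : ℕ) → List (Vec A k)
vectorsOver D zero    = Vec.[] ∷ []
vectorsOver D (suc k) = concatMap (λ d → map (d Vec.∷_) (vectorsOver D k)) D

vectorsOver-complete : ∀ {A : Set} (D : List A) {k} (v : Vec A k) →
                       (∀ i → Vec.lookup v i ∈ D) → v ∈ vectorsOver D k
vectorsOver-complete D Vec.[]       inD = here refl
vectorsOver-complete D (x Vec.∷ v) inD =
  ∈-concatMap⁺ (λ d → map (d Vec.∷_) (vectorsOver D _))
    (Any.map (λ { refl → ∈-map⁺ (x Vec.∷_) (vectorsOver-complete D v (inD ∘ Fin.suc)) })
             (inD Fin.zero))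

functionsOver : ∀ {A : Set} → List A → (n : ℕ) → List (Fin n → A)
functionsOver D n = map Vec.lookup (vectorsOver D n)

functionsOver-complete : ∀ {A : Set} (D : List A) {n} (f : Fin n → A) →
                         (∀ i → f i ∈ D) → ∃ λ g → g ∈ functionsOver D n × g ≗ f
functionsOver-complete D f inD =
  Vec.lookup (Vec.tabulate f) ,
  ∈-map⁺ Vec.lookup (vectorsOver-complete D (Vec.tabulate f)
           (λ i → subst (_∈ D) (sym (VecP.lookup∘tabulate f i)) (inD i))) ,
  VecP.lookup∘tabulate f

cons : ∀ {n} {C : Fin (suc n) → Set} → C Fin.zero → ((i : Fin n) → C (Fin.suc i)) → (i : Fin (suc n)) → C i
cons c f Fin.zero    = c
cons c f (Fin.suc i) = f i

choices : (n : ℕ) (C : Fin n → Set) → ((i : Fin n) → List (C i)) → List ((i : Fin n) → C i)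
choices zero    C ls = (λ ()) ∷ []
choices (suc n) C ls =
  concatMap (λ c → map (cons c) (choices n (C ∘ Fin.suc) (ls ∘ Fin.suc))) (ls Fin.zero)

choices-complete : ∀ n (C : Fin n → Set) (ls : (i : Fin n) → List (C i)) (f : (i : Fin n) → C i) →
                   (∀ i → f i ∈ ls i) → ∃ λ g → g ∈ choices n C ls × (∀ i → g i ≡ f i)
choices-complete zero    C ls f inL = (λ ()) , here refl , λ ()
choices-complete (suc n) C ls f inL
  with g , g∈ , g≗ ← choices-complete n (C ∘ Fin.suc) (ls ∘ Fin.suc) (f ∘ Fin.suc) (inL ∘ Fin.suc) =
  cons (f Fin.zero) g ,
  ∈-concatMap⁺ (λ c → map (cons c) (choices n (C ∘ Fin.suc) (ls ∘ Fin.suc)))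
    (Any.map (λ { refl → ∈-map⁺ (cons (f Fin.zero)) g∈ }) (inL Fin.zero)) ,
  λ { Fin.zero → refl ; (Fin.suc i) → g≗ i }

sublists : ∀ {A : Set} → List A → List (List A)
sublists []       = [] ∷ []
sublists (x ∷ xs) = map (x ∷_) (sublists xs) ++ sublists xs

filter∈sublists : ∀ {A : Set} {P : A → Set} (P? : ∀ x → Dec (P x)) (xs : List A) →
                  filter P? xs ∈ sublists xs
filter∈sublists P? []       = here refl
filter∈sublists P? (x ∷ xs) with P? x
... | yes _ = ∈-++⁺ˡ (∈-map⁺ (x ∷_) (filter∈sublists P? xs))
... | no  _ = ∈-++⁺ʳ (map (x ∷_) (sublists xs)) (filter∈sublists P? xs)

_∈ℕ?_ : (v : ℕ) (xs : List ℕ) → Dec (v ∈ xs)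
v ∈ℕ? xs = Any.any? (v ℕ.≟_) xs

shrink : ∀ (D : List ℕ) → 0 ∈ D → ∀ {n} (h : Fin n → ℕ) →
         ∃ λ g → g ∈ functionsOver D n × (∀ x → h x ∈ D → g x ≡ h x)
shrink D 0∈D {n} h =
  let g , g∈ , g≗ = functionsOver-complete D clamp clamp∈D
  in g , g∈ , λ x hx∈D → trans (g≗ x) (clamp≡ x hx∈D)
  where
  clamp : Fin n → ℕ
  clamp x with h x ∈ℕ? D
  ... | yes _ = h x
  ... | no  _ = 0

  clamp∈D : ∀ x → clamp x ∈ D
  clamp∈D x with h x ∈ℕ? D
  ... | yes hx∈D = hx∈D
  ... | no  _    = 0∈D

  clamp≡ : ∀ x → h x ∈ D → clamp x ≡ h x
  clamp≡ x hx∈D with h x ∈ℕ? D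
  ... | yes _   = refl
  ... | no  hx∉ = ⊥-elim (hx∉ hx∈D)

module PositionCode (N : List ℕ) (N≢0 : All (_≢ 0) N) where

  entryOr1 : List ℕ → ℕ → ℕ
  entryOr1 []       c       = 1
  entryOr1 (x ∷ xs) zero    = x
  entryOr1 (x ∷ xs) (suc c) = entryOr1 xs c

  decode : ℕ → ℕ
  decode = entryOr1 (0 ∷ N)

  encode : ℕ → ℕ
  encode v with v ∈ℕ? (0 ∷ N)
  ... | yes v∈ = toℕ (Any.index v∈)
  ... | no  _  = 0

  decode∘encode : ∀ {v} → v ∈ 0 ∷ N → decode (encode v) ≡ v
  decode∘encode {v} v∈ with v ∈ℕ? (0 ∷ N)
  ... | yes p  = entryOr1-index (0 ∷ N) p
    where
    entryOr1-index : ∀ xs (p : v ∈ xs) → entryOr1 xs (toℕ (Any.index p)) ≡ v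
    entryOr1-index (x ∷ xs) (here refl) = refl
    entryOr1-index (x ∷ xs) (there p)   = entryOr1-index xs p
  ... | no  v∉ = ⊥-elim (v∉ v∈)

  encode< : ∀ v → encode v < suc (length N)
  encode< v with v ∈ℕ? (0 ∷ N)
  ... | yes v∈ = toℕ<n (Any.index v∈)
  ... | no  _  = s≤s z≤n

  decode≡0 : ∀ c → decode c ≡ 0 → c ≡ 0
  decode≡0 zero    _ = refl
  decode≡0 (suc c) e = ⊥-elim (entryOr1≢0 N c N≢0 e)
    where
    entryOr1≢0 : ∀ xs c → All (_≢ 0) xs → entryOr1 xs c ≢ 0
    entryOr1≢0 []       c       _          ()
    entryOr1≢0 (x ∷ xs) zero    (x≢0 ∷ _)  = x≢0
    entryOr1≢0 (x ∷ xs) (suc c) (_ ∷ xs≢0) = entryOr1≢0 xs c xs≢0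

module Pairing (m : ℕ) where

  M : ℕ
  M = suc m

  pair : ℕ → ℕ → ℕ
  pair a b = a + b * M

  pair-quot : ∀ {a} b → a < M → pair a b / M ≡ b
  pair-quot {a} b a<M = begin
    (a + b * M) / M    ≡⟨ DivMod.+-distrib-/-∣ʳ a (n∣m*n b) ⟩
    a / M + b * M / M  ≡⟨ cong₂ _+_ (DivMod.m<n⇒m/n≡0 a<M) (DivMod.m*n/n≡m b M) ⟩
    b                  ∎
    where open ≡-Reasoning

  pair-rem : ∀ {a} b → a < M → pair a b % M ≡ a
  pair-rem {a} b a<M = trans (DivMod.[m+kn]%n≡m%n a b M) (DivMod.m<n⇒m%n≡m a<M)

  rem-small : ∀ n → n / M ≡ 0 → n % M ≡ n
  rem-small n e = DivMod.m<n⇒m%n≡m (DivMod.m/n≡0⇒m<n e)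

  pairs-quot : ∀ {k} (a b : Vec ℕ k) → (∀ {y} → y ∈ Vec.toList a → y < M) →
               Vec.map (_/ M) (Vec.zipWith pair a b) ≡ b
  pairs-quot Vec.[]       Vec.[]       a<M = refl
  pairs-quot (x Vec.∷ a) (y Vec.∷ b) a<M =
    cong₂ Vec._∷_ (pair-quot y (a<M (here refl))) (pairs-quot a b (a<M ∘ there))

  pairs-rem : ∀ {k} (a b : Vec ℕ k) → (∀ {y} → y ∈ Vec.toList a → y < M) →
              Vec.map (_% M) (Vec.zipWith pair a b) ≡ a
  pairs-rem Vec.[]       Vec.[]       a<M = refl
  pairs-rem (x Vec.∷ a) (y Vec.∷ b) a<M =
    cong₂ Vec._∷_ (pair-rem y (a<M (here refl))) (pairs-rem a b (a<M ∘ there))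

module Disclosure (𝒮 : DSchema) (V : DView 𝒮) where
  open DSchema 𝒮

  Inst : Set
  Inst = Instance 𝒮

  Query : Set
  Query = CQ 𝒮

  Valuation : Query → Set
  Valuation q = Fin (nVars q) → ℕ

  Hom : Inst → (q : Query) → Valuation q → Set
  Hom I q h = All (λ a → Vec.map h (args a) ∈ I (rel a)) (body q)

  hom? : ∀ I q h → Dec (Hom I q h)
  hom? I q h =
    All.all? (λ a → any? (VecP.≡-dec ℕ._≟_ (Vec.map h (args a))) (I (rel a))) (body q)

  Occurs : (q : Query) → Fin (nVars q) → Set
  Occurs q x = Any (λ a → x ∈ Vec.toList (args a)) (body q)

  occurs? : (q : Query) (x : Fin (nVars q)) → Dec (Occurs q x)
  occurs? q x = any? (λ a → _∈?F_ 𝒮 x (Vec.toList (args a))) (body q)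

  Safe : Query → Set
  Safe q = ∀ {x} → x ∈ head q → Occurs q x

  Hom-cong : ∀ {I} q {h g} → (∀ {x} → Occurs q x → g x ≡ h x) → Hom I q h → Hom I q g
  Hom-cong {I} q g≡h hom = All.tabulate λ {a} a∈ →
    subst (_∈ I (rel a)) (sym (vmap-cong-∈ (args a) (λ x∈ → g≡h (lose a∈ x∈))))
      (All.lookup hom a∈)

  Sat-transfer : ∀ {I J : Inst} q → All (λ a → I (rel a) ≡ J (rel a)) (body q) →
                 ∀ {t} → Sat 𝒮 I q t → Sat 𝒮 J q t
  Sat-transfer q I≡J (h , hom , hd) =
    h , All.zipWith (λ {a} (e , m) → subst (Vec.map h (args a) ∈_) e m) (I≡J , hom) , hd

  Sat-⇔ : ∀ {I J : Inst} q → All (λ a → I (rel a) ≡ J (rel a)) (body q) →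
          ∀ t → Sat 𝒮 I q t ⇔ Sat 𝒮 J q t
  Sat-⇔ q I≡J t = mk⇔ (Sat-transfer q I≡J) (Sat-transfer q (All.map sym I≡J))

  override : (q : Query) → Valuation q → Valuation q → Valuation q
  override q f g x with occurs? q x
  ... | yes _ = f x
  ... | no  _ = g x

  override-occurs : ∀ q f g {x} → Occurs q x → override q f g x ≡ f x
  override-occurs q f g {x} occ with occurs? q x
  ... | yes _    = refl
  ... | no  ¬occ = ⊥-elim (¬occ occ)

  override-else : ∀ q f g {x} → (Occurs q x → f x ≡ g x) → override q f g x ≡ g x
  override-else q f g {x} f≡g with occurs? q x
  ... | yes occ = f≡g occ
  ... | no  _   = refl

  adom : Inst → List ℕ
  adom I = concatMap (λ r → concatMap Vec.toList (I r)) (allFin nRels)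

  ∈-adom : ∀ (I : Inst) {r} {w : Vec ℕ (arity r)} {y} → w ∈ I r → y ∈ Vec.toList w → y ∈ adom I
  ∈-adom I {r} w∈ y∈ =
    ∈-concatMap⁺ (λ r → concatMap Vec.toList (I r))
      (lose (∈-allFin r) (∈-concatMap⁺ Vec.toList (lose w∈ y∈)))

  hom-adom : ∀ {I} q {h} → Hom I q h → ∀ {x} → Occurs q x → h x ∈ adom I
  hom-adom {I} q hom occ =
    let a , a∈ , x∈ = find occ in ∈-adom I (All.lookup hom a∈) (∈-vmap⁺ _ (args a) x∈)

  Crit : Inst
  Crit r = Vec.replicate (arity r) 0 ∷ []

  zeros : Query → List ℕ
  zeros q = map (λ _ → 0) (head q)

  SatZ : Inst → Query → Set
  SatZ I q = Sat 𝒮 I q (zeros q)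

  Crit-satZ : ∀ q → SatZ Crit q
  Crit-satZ q =
    (λ _ → 0) , All.universal (λ a → here (VecP.map-const (args a) 0)) (body q) , refl

  Crit-atom-zero : ∀ {n} (a : Atom 𝒮 n) {h : Fin n → ℕ} → Vec.map h (args a) ∈ Crit (rel a) →
                   ∀ {x} → x ∈ Vec.toList (args a) → h x ≡ 0
  Crit-atom-zero a (here e) x∈ = vmap-≡-replicate (args a) e x∈

  Crit-hom-zero : ∀ q {h} → Hom Crit q h → ∀ {x} → Occurs q x → h x ≡ 0
  Crit-hom-zero q hom occ =
    let a , a∈ , x∈ = find occ in Crit-atom-zero a (All.lookup hom a∈) x∈

  ZeroHeads : Inst → Query → Set
  ZeroHeads J q = ∀ h → Hom J q h → All (λ x → Occurs q x → h x ≡ 0) (head q)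

  -- J answers q exactly as Crit does; this is the content of agreeing with
  -- Crit on the view q.
  CritAnswers : Inst → Query → Set
  CritAnswers J q = SatZ J q × ZeroHeads J q

  sameAnswers⇒CritAnswers : ∀ {J} q → (∀ t → Sat 𝒮 Crit q t ⇔ Sat 𝒮 J q t) → CritAnswers J q
  sameAnswers⇒CritAnswers q same =
    Equivalence.to (same (zeros q)) (Crit-satZ q) ,
    λ h hom → All.tabulate λ {x} x∈ occ →
      let hc , homc , hc≡h = Equivalence.from (same (map h (head q))) (h , hom , refl)
      in trans (sym (map-≡⇒∈ (head q) hc≡h x∈)) (Crit-hom-zero q homc occ)

  CritAnswers⇒sameAnswers : ∀ {J} q → CritAnswers J q → ∀ t → Sat 𝒮 Crit q t ⇔ Sat 𝒮 J q t
  CritAnswers⇒sameAnswers {J} q ((hz , homz , hz≡0) , zeroHeads) t = mk⇔ toJ toCrit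
    where
    -- a Crit-match only constrains occurring variables, which it sends to 0 as hz does
    toJ : Sat 𝒮 Crit q t → Sat 𝒮 J q t
    toJ (hc , homc , hd) =
      override q hz hc , Hom-cong q (override-occurs q hz hc) homz ,
      trans (map-cong-∈ (head q) λ x∈ → override-else q hz hc λ occ →
               trans (map-≡⇒∈ (head q) hz≡0 x∈) (sym (Crit-hom-zero q homc occ)))
            hd
    -- a J-match sends occurring head variables to 0, as the all-zero Crit-match does
    toCrit : Sat 𝒮 J q t → Sat 𝒮 Crit q t
    toCrit (h , hom , hd) =
      override q (λ _ → 0) h ,
      Hom-cong q (override-occurs q (λ _ → 0) h) (proj₁ (proj₂ (Crit-satZ q))) ,
      trans (map-cong-∈ (head q) λ x∈ → override-else q (λ _ → 0) h λ occ →
               sym (All.lookup (zeroHeads h hom) x∈ occ))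
            hd

  AgreesWithCrit : Inst → Set
  AgreesWithCrit J = ViewsAgree 𝒮 V Crit J

  CritLike : Inst → Set
  CritLike J = ∀ s → All (CritAnswers J) (V s)

  agree⇒CritLike : ∀ {J} → AgreesWithCrit J → CritLike J
  agree⇒CritLike ag s = All.tabulate λ {q} q∈ → sameAnswers⇒CritAnswers q (ag s q q∈)

  CritLike⇒agree : ∀ {J} → CritLike J → AgreesWithCrit J
  CritLike⇒agree cl s q q∈ = CritAnswers⇒sameAnswers q (All.lookup (cl s) q∈)

  DeterminedAtCrit : Query → Set
  DeterminedAtCrit Q = ∀ J → AgreesWithCrit J → SatZ J Q

  nonDisclosing⇒undetermined : ∀ Q → UNNonDisclosing 𝒮 V Q → ¬ DeterminedAtCrit Q
  nonDisclosing⇒undetermined Q nd det =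
    nd Crit (zeros Q) (Crit-satZ Q) λ J ag → mk⇔ (λ _ → det J ag) (λ _ → Crit-satZ Q)

  -- Deciding CritAnswers: it suffices to search valuations with values in
  -- 0 ∷ adom J, since every match can be shrunk to one of them.
  Dom : Inst → List ℕ
  Dom J = 0 ∷ adom J

  shrink-hom : ∀ {J} q {h g} → Hom J q h → (∀ x → h x ∈ Dom J → g x ≡ h x) → Hom J q g
  shrink-hom q hom g≡h = Hom-cong q (λ occ → g≡h _ (there (hom-adom q hom occ))) hom

  satZ? : ∀ J q → Dec (SatZ J q)
  satZ? J q = map′ fromSmall toSmall
    (any? (λ g → hom? J q g ×-dec ListP.≡-dec ℕ._≟_ (map g (head q)) (zeros q))
          (functionsOver (Dom J) (nVars q)))
    where
    fromSmall : Any (λ g → Hom J q g × map g (head q) ≡ zeros q) _ → SatZ J q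
    fromSmall found = let g , hom , hd = Any.satisfied found in g , hom , hd
    toSmall : SatZ J q → Any (λ g → Hom J q g × map g (head q) ≡ zeros q) _
    toSmall (h , hom , hd) =
      let g , g∈ , g≡h = shrink (Dom J) (here refl) h
          head∈Dom : ∀ {x} → x ∈ head q → h x ∈ Dom J
          head∈Dom x∈ = subst (_∈ Dom J) (sym (map-≡⇒∈ (head q) hd x∈)) (here refl)
      in lose g∈ (shrink-hom q hom g≡h ,
                  trans (map-cong-∈ (head q) λ x∈ → g≡h _ (head∈Dom x∈)) hd)

  zeroHeads? : ∀ J q → Dec (ZeroHeads J q)
  zeroHeads? J q = map′ fromSmall (λ zh → All.tabulate λ {g} _ → zh g)
    (All.all? (λ g → hom? J q g →-dec All.all? (λ x → occurs? q x →-dec (g x ℕ.≟ 0)) (head q))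
              (functionsOver (Dom J) (nVars q)))
    where
    fromSmall : All (λ g → Hom J q g → All (λ x → Occurs q x → g x ≡ 0) (head q)) _ → ZeroHeads J q
    fromSmall small h hom =
      let g , g∈ , g≡h = shrink (Dom J) (here refl) h
      in All.map (λ {x} g≡0 occ → trans (sym (g≡h x (there (hom-adom q hom occ)))) (g≡0 occ))
                 (All.lookup small g∈ (shrink-hom q hom g≡h))

  critAnswers? : ∀ J q → Dec (CritAnswers J q)
  critAnswers? J q = satZ? J q ×-dec zeroHeads? J q

  allViews : List Query
  allViews = concatMap V (allFin nSources)

  ∈-allViews : ∀ {s q} → q ∈ V s → q ∈ allViews
  ∈-allViews {s} q∈ = ∈-concatMap⁺ V (lose (∈-allFin s) q∈)

  source-of-view : ∀ {q} → q ∈ allViews → ∃ λ s → q ∈ V s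
  source-of-view q∈ =
    let s , _ , q∈s = find (∈-concatMap⁻ V {xs = allFin nSources} q∈) in s , q∈s

  bound : ℕ
  bound = suc (sum (map nVars allViews))

  smallFacts : (r : Fin nRels) → List (Vec ℕ (arity r))
  smallFacts r = vectorsOver (upTo bound) (arity r)

  smallInstances : List Inst
  smallInstances =
    choices nRels (λ r → List (Vec ℕ (arity r))) (λ r → sublists (smallFacts r))

  Counterexample : Query → Inst → Set
  Counterexample Q J = CritLike J × ¬ SatZ J Q

  counterexample? : ∀ Q J → Dec (Counterexample Q J)
  counterexample? Q J =
    FinP.all? (λ s → All.all? (critAnswers? J) (V s)) ×-dec ¬? (satZ? J Q)

  -- Given J agreeing with Crit, fix one witness of
  -- q(0,...,0) in J for every view q and code the values these witnesses use
  -- (and 0) by their positions, which are below `bound`.  Pulling J back along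
  -- the decoding gives a small instance K that still agrees with Crit and maps
  -- homomorphically into J, so K refutes every Q(0,...,0) that J refutes.
  module Compress (J : Inst) (cl : CritLike J) where

    witnesses : All (SatZ J) allViews
    witnesses = All.tabulate λ q∈ →
      let s , q∈s = source-of-view q∈ in proj₁ (All.lookup (cl s) q∈s)

    values : ∀ {qs} → All (SatZ J) qs → List ℕ
    values []               = []
    values {q ∷ _} (w ∷ ws) = map (proj₁ w) (allFin (nVars q)) ++ values ws

    length-values : ∀ {qs} (ws : All (SatZ J) qs) → length (values ws) ≡ sum (map nVars qs)
    length-values []                = refl
    length-values {q ∷ qs} (w ∷ ws) = begin
      length (map (proj₁ w) (allFin (nVars q)) ++ values ws)
        ≡⟨ ListP.length-++ (map (proj₁ w) (allFin (nVars q))) ⟩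
      length (map (proj₁ w) (allFin (nVars q))) + length (values ws)
        ≡⟨ cong₂ _+_ (trans (ListP.length-map (proj₁ w) (allFin (nVars q))) (ListP.length-tabulate (λ x → x)))
                     (length-values ws) ⟩
      nVars q + sum (map nVars qs)
        ∎
      where open ≡-Reasoning

    ∈-values : ∀ {qs} (ws : All (SatZ J) qs) {q} (q∈ : q ∈ qs) x →
               proj₁ (All.lookup ws q∈) x ∈ values ws
    ∈-values (w ∷ ws) (here refl) x = ∈-++⁺ˡ (∈-map⁺ (proj₁ w) (∈-allFin x))
    ∈-values {q ∷ _} (w ∷ ws) (there q∈) x =
      ∈-++⁺ʳ (map (proj₁ w) (allFin (nVars q))) (∈-values ws q∈ x)

    used : List ℕ
    used = values witnesses

    nonzero? : (v : ℕ) → Dec (v ≢ 0)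
    nonzero? v = ¬? (v ℕ.≟ 0)

    open PositionCode (filter nonzero? used) (AllP.all-filter nonzero? used)

    ∈-coded : ∀ {v} → v ∈ used → v ∈ 0 ∷ filter nonzero? used
    ∈-coded {v} v∈ with v ℕ.≟ 0
    ... | yes refl = here refl
    ... | no  v≢0  = there (∈-filter⁺ nonzero? v∈ v≢0)

    -- codes are positions in 0 ∷ (nonzero used values), a list of length ≤ bound
    encode<bound : ∀ v → encode v < bound
    encode<bound v = ℕP.<-≤-trans (encode< v)
      (s≤s (ℕP.≤-trans (ListP.length-filter nonzero? used)
                       (ℕP.≤-reflexive (length-values witnesses))))

    pullback? : ∀ r (w : Vec ℕ (arity r)) → Dec (Vec.map decode w ∈ J r)
    pullback? r w = any? (VecP.≡-dec ℕ._≟_ (Vec.map decode w)) (J r)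

    chosen : ∃ λ K → K ∈ smallInstances × (∀ r → K r ≡ filter (pullback? r) (smallFacts r))
    chosen = choices-complete nRels _ _ (λ r → filter (pullback? r) (smallFacts r))
                              (λ r → filter∈sublists (pullback? r) (smallFacts r))

    K : Inst
    K = proj₁ chosen

    K-decodes : ∀ {r w} → w ∈ K r → Vec.map decode w ∈ J r
    K-decodes {r} w∈ =
      proj₂ (∈-filter⁻ (pullback? r) {xs = smallFacts r} (subst (_ ∈_) (proj₂ (proj₂ chosen) r) w∈))

    K-contains : ∀ {r w} → w ∈ smallFacts r → Vec.map decode w ∈ J r → w ∈ K r
    K-contains {r} w∈ dw∈ =
      subst (_ ∈_) (sym (proj₂ (proj₂ chosen) r)) (∈-filter⁺ (pullback? r) w∈ dw∈)

    decode-hom : ∀ q {g} → Hom K q g → Hom J q (decode ∘ g)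
    decode-hom q {g} = All.map λ {a} w∈ →
      subst (_∈ J (rel a)) (sym (VecP.map-∘ decode g (args a))) (K-decodes w∈)

    encode-satZ : ∀ {q} → q ∈ allViews → SatZ K q
    encode-satZ {q} q∈ = encode ∘ h , All.map encodeFact hom , encodeHead
      where
      h : Valuation q
      h = proj₁ (All.lookup witnesses q∈)
      hom : Hom J q h
      hom = proj₁ (proj₂ (All.lookup witnesses q∈))
      hd : map h (head q) ≡ zeros q
      hd = proj₂ (proj₂ (All.lookup witnesses q∈))
      encodeFact : ∀ {a : Atom 𝒮 (nVars q)} →
                   Vec.map h (args a) ∈ J (rel a) → Vec.map (encode ∘ h) (args a) ∈ K (rel a)
      encodeFact {a} fact = K-contains small (subst (_∈ J (rel a)) (sym decodes) fact)
        where
        small : Vec.map (encode ∘ h) (args a) ∈ smallFacts (rel a)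
        small = vectorsOver-complete (upTo bound) _ λ i →
          subst (_∈ upTo bound) (sym (VecP.lookup-map i (encode ∘ h) (args a)))
                (∈-upTo⁺ (encode<bound (h (Vec.lookup (args a) i))))
        decodes : Vec.map decode (Vec.map (encode ∘ h) (args a)) ≡ Vec.map h (args a)
        decodes = trans (sym (VecP.map-∘ decode (encode ∘ h) (args a)))
                        (VecP.map-cong (λ x → decode∘encode (∈-coded (∈-values witnesses q∈ x))) (args a))
      -- encode 0 computes to 0
      encodeHead : map (encode ∘ h) (head q) ≡ zeros q
      encodeHead =
        trans (ListP.map-∘ (head q)) (trans (cong (map encode) hd) (sym (ListP.map-∘ (head q))))

    K-CritLike : CritLike K
    K-CritLike s = All.tabulate λ {q} q∈ →
      encode-satZ (∈-allViews q∈) ,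
      λ g hom → All.map (λ dg≡0 occ → decode≡0 _ (dg≡0 occ))
                        (proj₂ (All.lookup (cl s) q∈) (decode ∘ g) (decode-hom q hom))

    decode-satZ : ∀ Q → SatZ K Q → SatZ J Q
    decode-satZ Q (g , hom , hd) =
      decode ∘ g , decode-hom Q hom ,
      trans (ListP.map-∘ (head Q)) (trans (cong (map decode) hd) (sym (ListP.map-∘ (head Q))))

    noSmallCounterexample⇒satZ : ∀ Q → ¬ Any (Counterexample Q) smallInstances → SatZ J Q
    noSmallCounterexample⇒satZ Q none with satZ? K Q
    ... | yes satK = decode-satZ Q satK
    ... | no ¬satK = ⊥-elim (none (lose (proj₁ (proj₂ chosen)) (K-CritLike , ¬satK)))

  detAtCrit? : ∀ Q → Dec (DeterminedAtCrit Q)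
  detAtCrit? Q with any? (counterexample? Q) smallInstances
  ... | yes found =
    let K , cl , ¬satZ = Any.satisfied found in no λ det → ¬satZ (det K (CritLike⇒agree cl))
  ... | no none =
    yes λ J ag → Compress.noSmallCounterexample⇒satZ J (agree⇒CritLike ag) Q none

  -- Product construction.  P pairs the facts of I with those of J, coding a
  -- pair of values as one number; the two projections are homomorphisms.
  module Product (I J : Inst) where
    open Pairing (sum (adom I)) public using (M; pair)
    open Pairing (sum (adom I)) using (pairs-rem; pairs-quot; rem-small)

    adom<M : ∀ {v} → v ∈ adom I → v < M
    adom<M v∈ = s≤s (≤-sum (adom I) v∈)

    P : Inst
    P r = cartesianProductWith (Vec.zipWith pair) (I r) (J r)

    P-fst : ∀ {r w} → w ∈ P r → Vec.map (_% M) w ∈ I r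
    P-fst {r} w∈ with a , b , a∈ , b∈ , refl ← ∈-cartesianProductWith⁻ (Vec.zipWith pair) (I r) (J r) w∈ =
      subst (_∈ I r) (sym (pairs-rem a b (adom<M ∘ ∈-adom I a∈))) a∈

    P-snd : ∀ {r w} → w ∈ P r → Vec.map (_/ M) w ∈ J r
    P-snd {r} w∈ with a , b , a∈ , b∈ , refl ← ∈-cartesianProductWith⁻ (Vec.zipWith pair) (I r) (J r) w∈ =
      subst (_∈ J r) (sym (pairs-quot a b (adom<M ∘ ∈-adom I a∈))) b∈

    P-fst-hom : ∀ q {h} → Hom P q h → Hom I q (λ x → h x % M)
    P-fst-hom q {h} = All.map λ {a} w∈ →
      subst (_∈ I (rel a)) (sym (VecP.map-∘ (_% M) h (args a))) (P-fst w∈)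

    P-snd-hom : ∀ q {h} → Hom P q h → Hom J q (λ x → h x / M)
    P-snd-hom q {h} = All.map λ {a} w∈ →
      subst (_∈ J (rel a)) (sym (VecP.map-∘ (_/ M) h (args a))) (P-snd w∈)

    -- If J agrees with Crit, P agrees with I on every view: pairing with the
    -- all-zero witness in J lifts answers of I, and matches in P project to
    -- I without changing head values, which J forces to be paired with 0.
    P-agrees : CritLike J → ViewsAgree 𝒮 V I P
    P-agrees cl s q q∈ t = mk⇔ toP toI
      where
      hz : Valuation q
      hz = proj₁ (proj₁ (All.lookup (cl s) q∈))
      homz : Hom J q hz
      homz = proj₁ (proj₂ (proj₁ (All.lookup (cl s) q∈)))
      hz≡0 : map hz (head q) ≡ zeros q
      hz≡0 = proj₂ (proj₂ (proj₁ (All.lookup (cl s) q∈)))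
      zeroHeads : ZeroHeads J q
      zeroHeads = proj₂ (All.lookup (cl s) q∈)

      toP : Sat 𝒮 I q t → Sat 𝒮 P q t
      toP (h , hom , hd) =
        (λ x → pair (h x) (hz x)) ,
        All.zipWith (λ {a} (fI , fJ) →
          subst (_∈ P (rel a)) (sym (vmap-zipWith pair h hz (args a)))
                (∈-cartesianProductWith⁺ (Vec.zipWith pair) fI fJ))
          (hom , homz) ,
        trans (map-cong-∈ (head q) λ {x} x∈ →
                 trans (cong (pair (h x)) (map-≡⇒∈ (head q) hz≡0 x∈)) (ℕP.+-identityʳ (h x)))
              hd

      toI : Sat 𝒮 P q t → Sat 𝒮 I q t
      toI (h , hom , hd) =
        override q (λ x → h x % M) h ,
        Hom-cong q (override-occurs q _ h) (P-fst-hom q hom) ,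
        trans (map-cong-∈ (head q) λ {x} x∈ → override-else q _ h λ occ →
                 rem-small (h x) (All.lookup (zeroHeads _ (P-snd-hom q hom)) x∈ occ))
              hd

  -- If some J agreeing with Crit refutes Q(0,...,0), then for every I and t
  -- with I ⊨ Q(t) the product of I and J agrees with I on the views but
  -- refutes Q(t): its second projection would otherwise satisfy Q(0,...,0).
  undetermined⇒nonDisclosing : ∀ Q → Safe Q → ¬ DeterminedAtCrit Q → UNNonDisclosing 𝒮 V Q
  undetermined⇒nonDisclosing Q safe undet I t satI@(h , hom , hd) det = undet λ J ag →
    let open Product I J
        hP , homP , hdP = Equivalence.to (det P (P-agrees (agree⇒CritLike ag))) satI
    in (λ x → hP x / M) , P-snd-hom Q homP ,
       map-cong-∈ (head Q) λ {x} x∈ → begin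
         hP x / M  ≡⟨ cong (_/ M) (map-≡⇒∈ (head Q) (trans hdP (sym hd)) x∈) ⟩
         h x / M   ≡⟨ DivMod.m<n⇒m/n≡0 (adom<M (hom-adom Q hom (safe x∈))) ⟩
         0         ∎
    where open ≡-Reasoning

  SJVar-occurs : ∀ Q s {x} → x ∈ SJVars 𝒮 s Q → OccursInSource 𝒮 Q s x × OccursInOtherSource 𝒮 Q s x
  SJVar-occurs Q s x∈ =
    proj₂ (∈-filter⁻ (λ x → occursInSource? 𝒮 Q s x ×-dec occursInOtherSource? 𝒮 Q s x)
                     {xs = allFin (nVars Q)} x∈)

  SJVar-intro : ∀ Q {x a b} → a ∈ body Q → b ∈ body Q → source (rel b) ≢ source (rel a) →
                x ∈ Vec.toList (args a) → x ∈ Vec.toList (args b) → x ∈ SJVars 𝒮 (source (rel a)) Q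
  SJVar-intro Q {x} a∈ b∈ b≢a x∈a x∈b =
    ∈-filter⁺ (λ x → occursInSource? 𝒮 Q _ x ×-dec occursInOtherSource? 𝒮 Q _ x) (∈-allFin x)
      (lose a∈ (refl , x∈a) , lose b∈ (b≢a , x∈b))

  restrictTo : Fin nSources → Inst → Inst
  restrictTo s J r with source r ≟ s
  ... | yes _ = J r
  ... | no  _ = Crit r

  restrict-in : ∀ s J r → source r ≡ s → restrictTo s J r ≡ J r
  restrict-in s J r r∈s with source r ≟ s
  ... | yes _   = refl
  ... | no  r∉s = ⊥-elim (r∉s r∈s)

  restrict-out : ∀ s J r → source r ≢ s → restrictTo s J r ≡ Crit r
  restrict-out s J r r∉s with source r ≟ s
  ... | yes r∈s = ⊥-elim (r∉s r∈s)
  ... | no  _   = refl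

  -- Views only read their own source, so restricting an instance agreeing
  -- with Crit to one source keeps it agreeing with Crit.
  restrict-agrees : IsDView 𝒮 V → ∀ s {J} → AgreesWithCrit J → AgreesWithCrit (restrictTo s J)
  restrict-agrees isDV s {J} ag s′ q q∈ t with s′ ≟ s
  ... | yes refl =
    ⇔.trans (ag s q q∈ t)
            (Sat-⇔ q (All.map (λ {a} a∈s → sym (restrict-in s J (rel a) a∈s)) (All.lookup (isDV s) q∈)) t)
  ... | no s′≢s =
    Sat-⇔ q (All.map (λ {a} a∈s′ → sym (restrict-out s J (rel a) (s′≢s ∘ trans (sym a∈s′))))
                     (All.lookup (isDV s′) q∈)) t

  -- Determinacy passes to each canonical view: evaluate Q on the restriction
  -- of J to s; the source-s atoms then land in J, while every source-join
  -- variable also occurs in an atom of another source, landing in Crit.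
  determined⇒canV-determined : IsDView 𝒮 V → ∀ Q s → DeterminedAtCrit Q → DeterminedAtCrit (CanV 𝒮 s Q)
  determined⇒canV-determined isDV Q s det J ag = h , homS , headZero
    where
    satR : SatZ (restrictTo s J) Q
    satR = det (restrictTo s J) (restrict-agrees isDV s ag)
    h : Valuation Q
    h = proj₁ satR
    hom : Hom (restrictTo s J) Q h
    hom = proj₁ (proj₂ satR)

    homS : Hom J (CanV 𝒮 s Q) h
    homS = All.tabulate λ {a} a∈ →
      let a∈Q , a∈s = ∈-filter⁻ (λ a → source (rel a) ≟ s) {xs = body Q} a∈
      in subst (Vec.map h (args a) ∈_) (restrict-in s J (rel a) a∈s) (All.lookup hom a∈Q)

    headZero : map h (SJVars 𝒮 s Q) ≡ zeros (CanV 𝒮 s Q)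
    headZero = map-cong-∈ (SJVars 𝒮 s Q) λ x∈ →
      let b , b∈ , b∉s , x∈b = find (proj₂ (SJVar-occurs Q s x∈))
      in Crit-atom-zero b {h}
           (subst (Vec.map h (args b) ∈_) (restrict-out s J (rel b) b∉s) (All.lookup hom b∈)) x∈b

  -- Conversely, for a Boolean Q determinacy of all canonical views gives
  -- determinacy of Q: glue the witnesses for the canonical views.  They are
  -- consistent, since a variable shared by atoms of two sources is a
  -- source-join variable of both, sent to 0 by both witnesses.
  canV-determined⇒determined : ∀ Q → IsBoolean 𝒮 Q → (∀ s → DeterminedAtCrit (CanV 𝒮 s Q)) →
                               DeterminedAtCrit Q
  canV-determined⇒determined Q boolean detS J ag = glued , homGlued , headGlued
    where
    H : Fin nSources → Valuation Q
    H s = proj₁ (detS s J ag)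

    H-sjv : ∀ s {x} → x ∈ SJVars 𝒮 s Q → H s x ≡ 0
    H-sjv s = map-≡⇒∈ (SJVars 𝒮 s Q) (proj₂ (proj₂ (detS s J ag)))

    glued : Valuation Q
    glued x with occurs? Q x
    ... | yes occ = H (source (rel (proj₁ (find occ)))) x
    ... | no  _   = 0

    glued-at : ∀ {a} → a ∈ body Q → ∀ {x} → x ∈ Vec.toList (args a) → glued x ≡ H (source (rel a)) x
    glued-at {a} a∈ {x} x∈a with occurs? Q x
    ... | no ¬occ = ⊥-elim (¬occ (lose a∈ x∈a))
    ... | yes occ with b , b∈ , x∈b ← find occ | source (rel b) ≟ source (rel a)
    ...   | yes b≡a = cong (λ s → H s x) b≡a
    ...   | no  b≢a = trans (H-sjv _ (SJVar-intro Q b∈ a∈ (b≢a ∘ sym) x∈b x∈a))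
                            (sym (H-sjv _ (SJVar-intro Q a∈ b∈ b≢a x∈a x∈b)))

    homGlued : Hom J Q glued
    homGlued = All.tabulate λ {a} a∈ →
      subst (_∈ J (rel a)) (sym (vmap-cong-∈ (args a) (glued-at a∈)))
        (All.lookup (proj₁ (proj₂ (detS (source (rel a)) J ag)))
                    (∈-filter⁺ (λ b → source (rel b) ≟ source (rel a)) a∈ refl))

    headGlued : map glued (head Q) ≡ zeros Q
    headGlued = subst (λ xs → map glued xs ≡ map (λ _ → 0) xs) (sym boolean) refl

  boolean-safe : ∀ Q → IsBoolean 𝒮 Q → Safe Q
  boolean-safe Q boolean x∈ with () ← subst (_ ∈_) boolean x∈

  canV-safe : ∀ Q s → Safe (CanV 𝒮 s Q)
  canV-safe Q s x∈ =
    let a , a∈ , a∈s , x∈a = find (proj₁ (SJVar-occurs Q s x∈))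
    in lose (∈-filter⁺ (λ a → source (rel a) ≟ s) a∈ a∈s) x∈a

mainTheorem11 : (𝒮 : DSchema) (V : DView 𝒮) → IsDView 𝒮 V →
    (Qsec : CQ 𝒮) → IsBoolean 𝒮 Qsec →
    (UNNonDisclosing 𝒮 V Qsec ⇔ ∃ λ s → UNNonDisclosing 𝒮 V (CanV 𝒮 s Qsec))
mainTheorem11 𝒮 V isDV Qsec boolean = mk⇔ forward backward
  where
  open Disclosure 𝒮 V
  open DSchema 𝒮 using (nSources)

  CanVDetermined : Fin nSources → Set
  CanVDetermined s = DeterminedAtCrit (CanV 𝒮 s Qsec)

  -- Qsec is not determined at Crit, so neither are all canonical views;
  -- by decidability one of them is not, and that one is non-disclosing.
  forward : UNNonDisclosing 𝒮 V Qsec → ∃ λ s → UNNonDisclosing 𝒮 V (CanV 𝒮 s Qsec)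
  forward nd with FinP.all? (λ s → detAtCrit? (CanV 𝒮 s Qsec))
  ... | yes allDet =
    ⊥-elim (nonDisclosing⇒undetermined Qsec nd (canV-determined⇒determined Qsec boolean allDet))
  ... | no notAll =
    let s , undet = FinP.¬∀⟶∃¬ nSources CanVDetermined (λ s → detAtCrit? (CanV 𝒮 s Qsec)) notAll
    in s , undetermined⇒nonDisclosing (CanV 𝒮 s Qsec) (canV-safe Qsec s) undet

  backward : (∃ λ s → UNNonDisclosing 𝒮 V (CanV 𝒮 s Qsec)) → UNNonDisclosing 𝒮 V Qsec
  backward (s , nd) =
    undetermined⇒nonDisclosing Qsec (boolean-safe Qsec boolean)
      (nonDisclosing⇒undetermined (CanV 𝒮 s Qsec) nd ∘ determined⇒canV-determined isDV Qsec s)
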